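{- Let $H$ be a $5$-regular $5$-edge-connected graph. Let $G$ be the bridgeless cubic graph obtained from $H$ by replacing every vertex $v$ of $H$ by a cycle of length five, the five edges of $H$ incident to $v$ being attached to the five distinct vertices of that cycle. Let $\overline{F}$ be the 2-factor of $G$ consisting of these $5$-cycles (so its complementary perfect matching $F$ consists of the edges corresponding to $E(H)$, and $G/\overline{F}$ is $H$). If $G/\overline{F}$ admits a non-conflicting nowhere-zero $\mathbb{Z}_2\times\mathbb{Z}_2$-flow with respect to $\overline{F}$, then $H$ contains two edge-disjoint perfect matchings.
   Context: Graphs are finite, loopless, and may have parallel edges. For a perfect matching $F$ of a cubic graph $G$, $\overline{F}=G-F$ is the complementary 2-factor, and $G/\overline{F}$ is the pseudo-graph obtained by contracting each cycle of $\overline{F}$ to a vertex; its edges are the edges of $F$. Write $\mathbb{Z}_2\times\mathbb{Z}_2=\{0,\alpha,\beta,\alpha+\beta\}$. A nowhere-zero $\mathbb{Z}_2\times\mathbb{Z}_2$-flow is an assignment $\theta$ of nonzero elements to the edges such that at every vertex the sum of values on incident edges is $0$ (loops counted twice). Such a flow of $G/\overline{F}$ is non-conflicting with respect to $\overline{F}$ if no edge $uv$ of $\overline{F}$ has $u$ incident to an edge of $F$ with value $\alpha$ and $v$ incident to an edge of $F$ with value $\beta$. -}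

module Defs where

open import Data.Nat using (ℕ; zero; suc; _+_; _≥_)
open import Data.Fin using (Fin; zero; suc)
open import Data.Bool using (Bool; true; false; _xor_; _∧_; if_then_else_; not)
open import Data.Product using (_×_; _,_; Σ; ∃)
open import Relation.Nullary using (¬_; yes; no)
open import Relation.Binary.PropositionalEquality using (_≡_; _≢_)
open import Function.Definitions using (Bijective)
import Data.Fin as Fin

-- Finite multigraphs (loopless, parallel edges allowed).
-- Vertices are Fin n, edges are Fin m; edge e has endpoints
-- end e false and end e true.  A half-edge is a pair (e , b).

record Multigraph : Set where
  field
    n   : ℕ
    m   : ℕ
    end : Fin m → Bool → Fin n
    loopless : (e : Fin m) → end e false ≢ end e true
open Multigraph public

sumℕ : (k : ℕ) → (Fin k → ℕ) → ℕ
sumℕ zero    f = 0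
sumℕ (suc k) f = f zero + sumℕ k (λ i → f (suc i))

isV : ∀ {k} → Fin k → Fin k → ℕ
isV u v with u Fin.≟ v
... | yes _ = 1
... | no  _ = 0

degIn : (H : Multigraph) → (Fin (m H) → Bool) → Fin (n H) → ℕ
degIn H S v = sumℕ (m H) (λ e →
  if S e then isV (end H e false) v + isV (end H e true) v else 0)

degree : (H : Multigraph) → Fin (n H) → ℕ
degree H v = degIn H (λ _ → true) v

Regular : ℕ → Multigraph → Set
Regular k H = (v : Fin (n H)) → degree H v ≡ k

cutSize : (H : Multigraph) → (Fin (n H) → Bool) → ℕ
cutSize H S = sumℕ (m H) (λ e →
  if S (end H e false) xor S (end H e true) then 1 else 0)

EdgeConnected : ℕ → Multigraph → Set
EdgeConnected k H =
  (S : Fin (n H) → Bool) →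
  ∃ (λ u → S u ≡ true) → ∃ (λ w → S w ≡ false) →
  cutSize H S ≥ k

PerfectMatching : (H : Multigraph) → (Fin (m H) → Bool) → Set
PerfectMatching H M = (v : Fin (n H)) → degIn H M v ≡ 1

EdgeDisjoint : (H : Multigraph) → (M₁ M₂ : Fin (m H) → Bool) → Set
EdgeDisjoint H M₁ M₂ = (e : Fin (m H)) → ¬ (M₁ e ≡ true × M₂ e ≡ true)

Z22 : Set
Z22 = Bool × Bool

0z : Z22
0z = false , false

α : Z22
α = true , false

β : Z22
β = false , true

_+z_ : Z22 → Z22 → Z22
(a , b) +z (c , d) = (a xor c) , (b xor d)

sumZ : (k : ℕ) → (Fin k → Z22) → Z22
sumZ zero    f = 0z
sumZ (suc k) f = f zero +z sumZ k (λ i → f (suc i))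

ifV : ∀ {k} → Fin k → Fin k → Z22 → Z22
ifV u v x with u Fin.≟ v
... | yes _ = x
... | no  _ = 0z

NZFlow : (H : Multigraph) → (Fin (m H) → Z22) → Set
NZFlow H θ =
  ((e : Fin (m H)) → θ e ≢ 0z) ×
  ((v : Fin (n H)) →
     sumZ (m H) (λ e → ifV (end H e false) v (θ e) +z ifV (end H e true) v (θ e)) ≡ 0z)

-- The cubic graph G obtained from H by replacing every vertex v by a
-- 5-cycle (v,0)(v,1)(v,2)(v,3)(v,4)(v,0).  The attachment `pos` says
-- that the end (e , b) of an edge of H is attached to the cycle vertex
-- (end e b , pos e b).  "The five edges at v are attached to the five
-- distinct vertices of the cycle" means: the map of half-edges to
-- cycle vertices is a bijection Fin m × Bool → Fin n × Fin 5.
-- The edges of G are the edges of F (= E(H), edge e joins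
-- attach (e,false) and attach (e,true)) and the cycle edges of F̄,
-- (v,i)(v,next i).

next5 : Fin 5 → Fin 5
next5 zero                            = suc zero
next5 (suc zero)                      = suc (suc zero)
next5 (suc (suc zero))                = suc (suc (suc zero))
next5 (suc (suc (suc zero)))          = suc (suc (suc (suc zero)))
next5 (suc (suc (suc (suc zero))))    = zero

attach : (H : Multigraph) → (Fin (m H) → Bool → Fin 5) →
         Fin (m H) × Bool → Fin (n H) × Fin 5
attach H pos (e , b) = end H e b , pos e b

ValidAttachment : (H : Multigraph) → (Fin (m H) → Bool → Fin 5) → Set
ValidAttachment H pos = Bijective _≡_ _≡_ (attach H pos)

-- θ is a flow of G/F̄ = H (its edges are the edges of F).  For a cycle
-- edge (v,i)(v,next i) of F̄, the F-edges at its ends are the edges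
-- e₁,e₂ of the half-edges attached there.
NonConflicting : (H : Multigraph) → (pos : Fin (m H) → Bool → Fin 5) →
                 (Fin (m H) → Z22) → Set
NonConflicting H pos θ =
  (v : Fin (n H)) (i : Fin 5) (e₁ : Fin (m H)) (b₁ : Bool)
  (e₂ : Fin (m H)) (b₂ : Bool) →
  attach H pos (e₁ , b₁) ≡ (v , i) →
  attach H pos (e₂ , b₂) ≡ (v , next5 i) →
  ¬ (θ e₁ ≡ α × θ e₂ ≡ β) × ¬ (θ e₁ ≡ β × θ e₂ ≡ α)

{-# OPTIONS --safe #-}
-- Around the 5-cycle of a vertex v the five F-edges carry nonzero values
-- summing to 0 in Z₂ × Z₂, so each of α, β, α+β occurs an odd number of
-- times: the multiplicities are a permutation of (1, 1, 3).  If α occurred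
-- three times, the single β would have two cycle neighbours, neither of
-- which may be α, while only one α+β is available; symmetrically for β.
-- Hence exactly one F-edge at v has value α and exactly one has value β,
-- i.e. θ⁻¹(α) and θ⁻¹(β) are disjoint perfect matchings of H.
module Submission where

open import Defs
open import Algebra.Bundles using (CommutativeMonoid)
open import Data.Bool using (Bool; true; false; if_then_else_)
import Data.Bool.Properties as Bool
open import Data.Fin using (Fin; zero; suc)
import Data.Fin as Fin
open import Data.Fin.Patterns using (0F; 1F; 2F; 3F; 4F)
open import Data.Fin.Properties using (punchInᵢ≢i; all?)
open import Data.Nat using (ℕ; zero; suc; _+_)
open import Data.Nat.Properties using (+-0-commutativeMonoid)
import Data.Nat.Properties as ℕ
open import Data.Product using (_×_; Σ; _,_; proj₁; proj₂; uncurry)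
import Data.Product.Properties as Product
open import Data.Vec.Functional using (Vector; _∷_; [])
open import Function using (_∘_)
open import Function.Definitions using (Injective)
open import Level using (0ℓ)
open import Relation.Binary.Definitions using (DecidableEquality)
open import Relation.Binary.PropositionalEquality using (_≡_; _≢_; refl; sym; trans; cong; cong₂; subst; subst₂)
open import Relation.Binary.PropositionalEquality.Algebra using (isMagma)
open import Relation.Nullary using (¬_; Dec; yes; no; does; map′; ¬?; _×-dec_; _→-dec_)
open import Relation.Nullary.Decidable using (from-yes)
open import Relation.Nullary.Negation using (contradiction)

module Summation {c ℓ} (M : CommutativeMonoid c ℓ) where

  open CommutativeMonoid M renaming (refl to ≈-refl; sym to ≈-sym; trans to ≈-trans)
  open import Algebra.Properties.CommutativeMonoid.Sum M public
  open import Relation.Binary.Reasoning.Setoid setoid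

  δ : ∀ {p} {P : Set p} → Dec P → Carrier → Carrier
  δ (yes _) x = x
  δ (no _)  x = ε

  δ-yes : ∀ {p} {P : Set p} (d : Dec P) {x} → P → δ d x ≈ x
  δ-yes (yes _) _ = ≈-refl
  δ-yes (no ¬p) p = contradiction p ¬p

  δ-no : ∀ {p} {P : Set p} (d : Dec P) {x} → ¬ P → δ d x ≈ ε
  δ-no (yes p) ¬p = contradiction p ¬p
  δ-no (no _)  _  = ≈-refl

  δ-ε : ∀ {p} {P : Set p} (d : Dec P) → δ d ε ≈ ε
  δ-ε (yes _) = ≈-refl
  δ-ε (no _)  = ≈-refl

  sum-single : ∀ {k} (f : Vector Carrier k) i → (∀ j → j ≢ i → f j ≈ ε) → sum f ≈ f i
  sum-single {suc k} f i zeros = begin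
    sum f                                     ≈⟨ sum-remove {i = i} f ⟩
    f i ∙ sum (λ j → f (Fin.punchIn i j))     ≈⟨ ∙-congˡ (sum-cong-≋ (λ j → zeros _ (punchInᵢ≢i i j))) ⟩
    f i ∙ sum {k} (λ _ → ε)                   ≈⟨ ∙-congˡ (sum-replicate-zero k) ⟩
    f i ∙ ε                                   ≈⟨ identityʳ (f i) ⟩
    f i                                       ∎

  ∑-δ-pair : ∀ {a} {A : Set a} (_≟_ : DecidableEquality A) {k} (u v : A) (p : Fin k) x →
             ∑[ i < k ] δ (Product.≡-dec _≟_ Fin._≟_ (u , p) (v , i)) x ≈ δ (u ≟ v) x
  ∑-δ-pair _≟_ {k} u v p x = by-cases (u ≟ v)
    where
    slot? : ∀ i → Dec ((u , p) ≡ (v , i))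
    slot? = Product.≡-dec _≟_ Fin._≟_ (u , p) ∘ (v ,_)

    by-cases : Dec (u ≡ v) → ∑[ i < k ] δ (slot? i) x ≈ δ (u ≟ v) x
    by-cases (yes u≡v) = ≈-trans (sum-single _ p off)
                                 (≈-trans (δ-yes (slot? p) (cong (_, p) u≡v)) (≈-sym (δ-yes (u ≟ v) u≡v)))
      where
      off : ∀ i → i ≢ p → δ (slot? i) x ≈ ε
      off i i≢p = δ-no (slot? i) (λ eq → i≢p (sym (cong proj₂ eq)))
    by-cases (no u≢v) = ≈-trans (sum-cong-≋ (λ i → δ-no (slot? i) (u≢v ∘ cong proj₁)))
                                (≈-trans (sum-replicate-zero k) (≈-sym (δ-no (u ≟ v) u≢v)))

  module _ (H : Multigraph) where

    sumAt : Fin (n H) → (Fin (m H) → Bool → Carrier) → Carrier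
    sumAt v φ = ∑[ e < m H ] (δ (end H e false Fin.≟ v) (φ e false) ∙ δ (end H e true Fin.≟ v) (φ e true))

    module _ (pos : Fin (m H) → Bool → Fin 5) (inj : Injective _≡_ _≡_ (attach H pos))
             (φ : Fin (m H) → Bool → Carrier) (v : Fin (n H)) where

      private
        attached? : ∀ e b i → Dec (attach H pos (e , b) ≡ (v , i))
        attached? e b i = Product.≡-dec Fin._≟_ Fin._≟_ (attach H pos (e , b)) (v , i)

        inSlot : Fin (m H) → Bool → Fin 5 → Carrier
        inSlot e b i = δ (attached? e b i) (φ e b)

        inSlot-elsewhere : ∀ {i e b e₀ b₀} → attach H pos (e₀ , b₀) ≡ (v , i) →
                           (e , b) ≢ (e₀ , b₀) → inSlot e b i ≈ ε
        inSlot-elsewhere {i} {e} {b} at ne = δ-no (attached? e b i) (λ eq → ne (inj (trans eq (sym at))))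

        edge-spread : ∀ e → δ (end H e false Fin.≟ v) (φ e false) ∙ δ (end H e true Fin.≟ v) (φ e true)
                          ≈ ∑[ i < 5 ] (inSlot e false i ∙ inSlot e true i)
        edge-spread e = ≈-sym (≈-trans (∑-distrib-+ (inSlot e false) (inSlot e true))
          (∙-cong (∑-δ-pair Fin._≟_ (end H e false) v (pos e false) (φ e false))
                  (∑-δ-pair Fin._≟_ (end H e true) v (pos e true) (φ e true))))

        slot-sum : ∀ i e₀ b₀ → attach H pos (e₀ , b₀) ≡ (v , i) →
                   ∑[ e < m H ] (inSlot e false i ∙ inSlot e true i) ≈ φ e₀ b₀
        slot-sum i e₀ b₀ at = ≈-trans (sum-single _ e₀ others) (here b₀ at)
          where
          others : ∀ e → e ≢ e₀ → inSlot e false i ∙ inSlot e true i ≈ ε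
          others e e≢e₀ = ≈-trans (∙-cong (inSlot-elsewhere at (e≢e₀ ∘ cong proj₁))
                                          (inSlot-elsewhere at (e≢e₀ ∘ cong proj₁)))
                                  (identityˡ ε)
          here : ∀ b₀ → attach H pos (e₀ , b₀) ≡ (v , i) → inSlot e₀ false i ∙ inSlot e₀ true i ≈ φ e₀ b₀
          here false at = ≈-trans (∙-cong (δ-yes (attached? e₀ _ i) at) (inSlot-elsewhere at λ ())) (identityʳ _)
          here true  at = ≈-trans (∙-cong (inSlot-elsewhere at λ ()) (δ-yes (attached? e₀ _ i) at)) (identityˡ _)

      -- Each edge-end is spread over the five slots of its vertex; after swapping
      -- the sums, injectivity of attach leaves exactly one edge-end in each slot.
      sumAt-reindex : (slot : Fin 5 → Fin (m H) × Bool) → (∀ i → attach H pos (slot i) ≡ (v , i)) →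
                      sumAt v φ ≈ ∑[ i < 5 ] uncurry φ (slot i)
      sumAt-reindex slot attached = begin
        sumAt v φ                                                   ≈⟨ sum-cong-≋ edge-spread ⟩
        ∑[ e < m H ] ∑[ i < 5 ] (inSlot e false i ∙ inSlot e true i) ≈⟨ ∑-comm (λ e i → inSlot e false i ∙ inSlot e true i) ⟩
        ∑[ i < 5 ] ∑[ e < m H ] (inSlot e false i ∙ inSlot e true i) ≈⟨ sum-cong-≋ (λ i → slot-sum i _ _ (attached i)) ⟩
        ∑[ i < 5 ] uncurry φ (slot i)                               ∎

+z-commutativeMonoid : CommutativeMonoid 0ℓ 0ℓ
+z-commutativeMonoid = record
  { Carrier = Z22
  ; _≈_ = _≡_
  ; _∙_ = _+z_
  ; ε = 0z
  ; isCommutativeMonoid = record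
    { isMonoid = record
      { isSemigroup = record
        { isMagma = isMagma _+z_
        ; assoc = λ { (a , b) (c , d) (e , f) → cong₂ _,_ (Bool.xor-assoc a c e) (Bool.xor-assoc b d f) }
        }
      ; identity = (λ _ → refl) , λ { (a , b) → cong₂ _,_ (Bool.xor-identityʳ a) (Bool.xor-identityʳ b) }
      }
    ; comm = λ { (a , b) (c , d) → cong₂ _,_ (Bool.xor-comm a c) (Bool.xor-comm b d) }
    }
  }

module ℕ-sums = Summation +-0-commutativeMonoid
module Z22-sums = Summation +z-commutativeMonoid

sumℕ≡sum : ∀ k f → sumℕ k f ≡ ℕ-sums.sum f
sumℕ≡sum zero    f = refl
sumℕ≡sum (suc k) f = cong (f zero +_) (sumℕ≡sum k (f ∘ suc))

sumZ≡sum : ∀ k f → sumZ k f ≡ Z22-sums.sum f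
sumZ≡sum zero    f = refl
sumZ≡sum (suc k) f = cong (f zero +z_) (sumZ≡sum k (f ∘ suc))

indicator : Bool → ℕ
indicator b = if b then 1 else 0

isV≡δ : ∀ {k} (u v : Fin k) → isV u v ≡ ℕ-sums.δ (u Fin.≟ v) 1
isV≡δ u v with u Fin.≟ v
... | yes _ = refl
... | no  _ = refl

ifV≡δ : ∀ {k} (u v : Fin k) x → ifV u v x ≡ Z22-sums.δ (u Fin.≟ v) x
ifV≡δ u v x with u Fin.≟ v
... | yes _ = refl
... | no  _ = refl

degIn≡sumAt : ∀ H S v → degIn H S v ≡ ℕ-sums.sumAt H v (λ e _ → indicator (S e))
degIn≡sumAt H S v = trans (sumℕ≡sum (m H) _) (ℕ-sums.sum-cong-≗ edge)
  where
  edge : ∀ e → (if S e then isV (end H e false) v + isV (end H e true) v else 0)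
             ≡ ℕ-sums.δ (end H e false Fin.≟ v) (indicator (S e)) + ℕ-sums.δ (end H e true Fin.≟ v) (indicator (S e))
  edge e with S e
  ... | true  = cong₂ _+_ (isV≡δ (end H e false) v) (isV≡δ (end H e true) v)
  ... | false = sym (cong₂ _+_ (ℕ-sums.δ-ε (end H e false Fin.≟ v)) (ℕ-sums.δ-ε (end H e true Fin.≟ v)))

flowAt≡sumAt : ∀ H (θ : Fin (m H) → Z22) v →
  sumZ (m H) (λ e → ifV (end H e false) v (θ e) +z ifV (end H e true) v (θ e)) ≡ Z22-sums.sumAt H v (λ e _ → θ e)
flowAt≡sumAt H θ v = trans (sumZ≡sum (m H) _) (Z22-sums.sum-cong-≗ λ e →
  cong₂ _+z_ (ifV≡δ (end H e false) v (θ e)) (ifV≡δ (end H e true) v (θ e)))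

_≟z_ : DecidableEquality Z22
_≟z_ = Product.≡-dec Bool._≟_ Bool._≟_

isα isβ : Z22 → Bool
isα x = does (x ≟z α)
isβ x = does (x ≟z β)

isα-isβ-exclusive : ∀ x → ¬ (isα x ≡ true × isβ x ≡ true)
isα-isβ-exclusive (true  , true)  (() , _)
isα-isβ-exclusive (true  , false) (_ , ())
isα-isβ-exclusive (false , _)     (() , _)

Compatible : Z22 → Z22 → Set
Compatible x y = ¬ (x ≡ α × y ≡ β) × ¬ (x ≡ β × y ≡ α)

compatible? : ∀ x y → Dec (Compatible x y)
compatible? x y = ¬? (x ≟z α ×-dec y ≟z β) ×-dec ¬? (x ≟z β ×-dec y ≟z α)

count : ∀ {k} → (Z22 → Bool) → Vector Z22 k → ℕ
count p x = ℕ-sums.sum (indicator ∘ p ∘ x)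

NonConflictingCycleFlow : Vector Z22 5 → Set
NonConflictingCycleFlow x =
  (∀ i → x i ≢ 0z) × Z22-sums.sum x ≡ 0z × (∀ i → Compatible (x i) (x (next5 i)))

OneαOneβ : Vector Z22 5 → Set
OneαOneβ x = count isα x ≡ 1 × count isβ x ≡ 1

∀-Z22? : ∀ {p} {P : Z22 → Set p} → (∀ x → Dec (P x)) → Dec (∀ x → P x)
∀-Z22? P? = map′
  (λ { (p₀ , pα , pβ , pγ) → λ { (false , false) → p₀ ; (true , false) → pα
                               ; (false , true) → pβ ; (true , true) → pγ } })
  (λ p → p _ , p _ , p _ , p _)
  (P? (false , false) ×-dec P? α ×-dec P? β ×-dec P? (true , true))

nonConflictingCycleFlow⇒oneαOneβ : ∀ x → NonConflictingCycleFlow x → OneαOneβ x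
nonConflictingCycleFlow⇒oneαOneβ x (nonzero , balanced , compatible) =
  exhaustive (x 0F) (x 1F) (x 2F) (x 3F) (x 4F)
    ( (λ i → subst (_≢ 0z) (sym (cycle-η i)) (nonzero i))
    , balanced
    , (λ i → subst₂ Compatible (sym (cycle-η i)) (sym (cycle-η (next5 i))) (compatible i)))
  where
  cycle : Z22 → Z22 → Z22 → Z22 → Z22 → Vector Z22 5
  cycle a b c d e = a ∷ b ∷ c ∷ d ∷ e ∷ []

  cycle-η : ∀ i → cycle (x 0F) (x 1F) (x 2F) (x 3F) (x 4F) i ≡ x i
  cycle-η 0F = refl
  cycle-η 1F = refl
  cycle-η 2F = refl
  cycle-η 3F = refl
  cycle-η 4F = refl

  -- The counting argument of the header, replaced by evaluation on all 4⁵ labellings.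
  exhaustive : ∀ a b c d e → NonConflictingCycleFlow (cycle a b c d e) → OneαOneβ (cycle a b c d e)
  exhaustive = from-yes (∀-Z22? λ a → ∀-Z22? λ b → ∀-Z22? λ c → ∀-Z22? λ d → ∀-Z22? λ e →
    let x = cycle a b c d e in
    (all? (λ i → ¬? (x i ≟z 0z)) ×-dec Z22-sums.sum x ≟z 0z ×-dec all? (λ i → compatible? (x i) (x (next5 i))))
    →-dec (count isα x ℕ.≟ 1 ×-dec count isβ x ℕ.≟ 1))

lemma2 : (H : Multigraph) → Regular 5 H → EdgeConnected 5 H →
    (pos : Fin (m H) → Bool → Fin 5) → ValidAttachment H pos →
    (θ : Fin (m H) → Z22) → NZFlow H θ → NonConflicting H pos θ →
    Σ (Fin (m H) → Bool) (λ M₁ → Σ (Fin (m H) → Bool) (λ M₂ →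
      PerfectMatching H M₁ × PerfectMatching H M₂ × EdgeDisjoint H M₁ M₂))
lemma2 H _ _ pos (injective , surjective) θ (nonzero , conserved) nonConflicting =
  isα ∘ θ , isβ ∘ θ , perfect isα proj₁ , perfect isβ proj₂ , isα-isβ-exclusive ∘ θ
  where
  slot : Fin (n H) → Fin 5 → Fin (m H) × Bool
  slot v i = proj₁ (surjective (v , i))

  slot-attached : ∀ v i → attach H pos (slot v i) ≡ (v , i)
  slot-attached v i = proj₂ (surjective (v , i)) refl

  around : Fin (n H) → Vector Z22 5
  around v i = θ (proj₁ (slot v i))

  balanced : ∀ v → Z22-sums.sum (around v) ≡ 0z
  balanced v = trans (sym (Z22-sums.sumAt-reindex H pos injective (λ e _ → θ e) v (slot v) (slot-attached v)))
                     (trans (sym (flowAt≡sumAt H θ v)) (conserved v))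

  oneαOneβ : ∀ v → OneαOneβ (around v)
  oneαOneβ v = nonConflictingCycleFlow⇒oneαOneβ (around v)
    ( (λ i → nonzero (proj₁ (slot v i)))
    , balanced v
    , λ i → nonConflicting v i _ _ _ _ (slot-attached v i) (slot-attached v (next5 i)))

  degIn-around : ∀ p v → degIn H (p ∘ θ) v ≡ count p (around v)
  degIn-around p v = trans (degIn≡sumAt H (p ∘ θ) v)
    (ℕ-sums.sumAt-reindex H pos injective (λ e _ → indicator (p (θ e))) v (slot v) (slot-attached v))

  perfect : ∀ p → (∀ {x} → OneαOneβ x → count p x ≡ 1) → PerfectMatching H (p ∘ θ)
  perfect p once v = trans (degIn-around p v) (once {around v} (oneαOneβ v))
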